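{- Let $m>1$ be an integer. Then for every integer $n$, $$\left\lfloor\frac nm\right\rfloor+\left\lfloor\frac{6n}m\right\rfloor\ge\left\lfloor\frac{2n}m\right\rfloor+\left\lfloor\frac{2n+1}m\right\rfloor+\left\lfloor\frac{3n}m\right\rfloor.$$
   Context: $\lfloor x\rfloor$ denotes the floor function. -}

module Defs where

open import Data.Nat.Base using (ℕ; NonZero)
open import Data.Integer.Base using (ℤ; _/ℕ_)

-- ⌊ n / m ⌋ for an integer n and a positive natural m.
-- Data.Integer.Base._/ℕ_ is Euclidean division by a positive divisor,
-- which coincides with floor division (remainder in [0, m)).
⌊_/_⌋ : ℤ → (m : ℕ) → .{{NonZero m}} → ℤ
⌊ n / m ⌋ = n /ℕ m

{-# OPTIONS --safe #-}
module Submission where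

-- Write n = q m + r with 0 ≤ r < m.  Every term ⌊(k n + c)/m⌋ splits as k q + ⌊(k r + c)/m⌋,
-- and the q-parts cancel since 2 + 2 + 3 = 1 + 6.  What is left is an inequality between
-- small floors of multiples of r/m ∈ [0, 1), settled by locating r relative to m/2 and 2m/3;
-- the hypothesis m > 1 enters only when 2r + 1 = m, where it forces r ≥ 1.

module ℕ-Floor where
  open import Data.Nat.Base
  open import Data.Nat.Properties
  open import Data.Nat.DivMod
  open import Data.Sum.Base using (inj₁; inj₂)
  open import Relation.Binary.PropositionalEquality
  open import Relation.Nullary.Negation using (contradiction)
  open import Data.Nat.Tactic.RingSolver using (solve)
  open import Data.List.Base using (_∷_; [])

  m<[1+n]*o⇒m/o≤n : ∀ {m} n o .{{_ : NonZero o}} → m < suc n * o → m / o ≤ n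
  m<[1+n]*o⇒m/o≤n n o m<[1+n]*o = s≤s⁻¹ (m<n*o⇒m/o<n m<[1+n]*o)

  n*o≤m⇒n≤m/o : ∀ {m} n o .{{_ : NonZero o}} → n * o ≤ m → n ≤ m / o
  n*o≤m⇒n≤m/o n o n*o≤m = subst (_≤ _ / o) (m*n/n≡m n o) (/-monoˡ-≤ o n*o≤m)

  m<n⇒m/n≤0 : ∀ {m n} .{{_ : NonZero n}} → m < n → m / n ≤ 0
  m<n⇒m/n≤0 m<n = ≤-reflexive (m<n⇒m/n≡0 m<n)

  m<n⇒1+2m<2n : ∀ {m n} → m < n → suc (2 * m) < 2 * n
  m<n⇒1+2m<2n {m} {n} m<n = subst (_≤ 2 * n) (*-suc 2 m) (*-monoʳ-≤ 2 m<n)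

  1<m≤1+2n⇒1≤n : ∀ {m} n → 1 < m → m ≤ suc (2 * n) → 1 ≤ n
  1<m≤1+2n⇒1≤n zero    1<m m≤1 = contradiction m≤1 (<⇒≱ 1<m)
  1<m≤1+2n⇒1≤n (suc _) _   _   = s≤s z≤n

  2n/m+[1+2n]/m≤2 : ∀ {m n} .{{_ : NonZero m}} → n < m → 2 * n / m + suc (2 * n) / m ≤ 2
  2n/m+[1+2n]/m≤2 {m} n<m =
    +-mono-≤ (m<[1+n]*o⇒m/o≤n 1 m (*-monoʳ-< 2 n<m)) (m<[1+n]*o⇒m/o≤n 1 m (m<n⇒1+2m<2n n<m))

  2r/m+[1+2r]/m+3r/m≤6r/m : ∀ m .{{_ : NonZero m}} r → 1 < m → r < m →
    2 * r / m + suc (2 * r) / m + 3 * r / m ≤ 6 * r / m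
  2r/m+[1+2r]/m+3r/m≤6r/m m r 1<m r<m with <-≤-connex (suc (2 * r)) m
  ... | inj₁ 1+2r<m =
    +-mono-≤ (+-mono-≤ (m<n⇒m/n≤0 (<-trans (n<1+n _) 1+2r<m)) (m<n⇒m/n≤0 1+2r<m))
             (/-monoˡ-≤ m (*-monoˡ-≤ r {3} {6} (s≤s (s≤s (s≤s z≤n)))))
  ... | inj₂ m≤1+2r with <-≤-connex (2 * r) m
  ...   | inj₁ 2r<m = ≤-trans (+-mono-≤ (+-mono-≤ 2r/m≤0 1+2r/m≤1) 3r/m≤1) 2≤6r/m
    where
    2r/m≤0 : 2 * r / m ≤ 0
    2r/m≤0 = m<n⇒m/n≤0 2r<m
    1+2r/m≤1 : suc (2 * r) / m ≤ 1
    1+2r/m≤1 = m<[1+n]*o⇒m/o≤n 1 m (m<n⇒1+2m<2n r<m)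
    3r/m≤1 : 3 * r / m ≤ 1
    3r/m≤1 = m<[1+n]*o⇒m/o≤n 1 m (+-mono-< r<m (subst (2 * r <_) (sym (+-identityʳ m)) 2r<m))
    2≤6r/m : 2 ≤ 6 * r / m
    2≤6r/m = n*o≤m⇒n≤m/o 2 m (begin
      2 * m             ≤⟨ *-monoʳ-≤ 2 m≤1+2r ⟩
      2 * suc (2 * r)   ≡⟨ solve (r ∷ []) ⟩
      2 + 4 * r         ≤⟨ +-monoˡ-≤ (4 * r) (*-monoʳ-≤ 2 (1<m≤1+2n⇒1≤n r 1<m m≤1+2r)) ⟩
      2 * r + 4 * r     ≡⟨ solve (r ∷ []) ⟩
      6 * r             ∎)
      where open ≤-Reasoning
  ...   | inj₂ m≤2r with <-≤-connex (3 * r) (2 * m)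
  ...     | inj₁ 3r<2m = ≤-trans (+-mono-≤ (2n/m+[1+2n]/m≤2 r<m) 3r/m≤1) 3≤6r/m
    where
    3r/m≤1 : 3 * r / m ≤ 1
    3r/m≤1 = m<[1+n]*o⇒m/o≤n 1 m 3r<2m
    3≤6r/m : 3 ≤ 6 * r / m
    3≤6r/m = n*o≤m⇒n≤m/o 3 m (subst (3 * m ≤_) (sym (*-assoc 3 2 r)) (*-monoʳ-≤ 3 m≤2r))
  ...     | inj₂ 2m≤3r = ≤-trans (+-mono-≤ (2n/m+[1+2n]/m≤2 r<m) 3r/m≤2) 4≤6r/m
    where
    3r/m≤2 : 3 * r / m ≤ 2
    3r/m≤2 = m<[1+n]*o⇒m/o≤n 2 m (*-monoʳ-< 3 r<m)
    4≤6r/m : 4 ≤ 6 * r / m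
    4≤6r/m = n*o≤m⇒n≤m/o 4 m (subst₂ _≤_ (sym (*-assoc 2 2 m)) (sym (*-assoc 2 3 r)) (*-monoʳ-≤ 2 2m≤3r))

open import Defs
open import Data.Nat.Base using (ℕ; NonZero) renaming (_<_ to _<ℕ_)
open import Data.Integer.Base using (ℤ; _+_; _*_; _≤_; +_)
open import Data.Integer.Base using (_<_; _/ℕ_; _%ℕ_; +≤+; +<+) renaming (suc to sucℤ)
open import Data.Integer.Properties
  using (≤-antisym; ≤-<-trans; i<j⇒i≤pred[j]; pred-suc; *-cancelʳ-<-nonNeg; i≤j+i; +-monoˡ-<; suc-*;
         pos-*; +-identityʳ; +-monoʳ-≤; module ≤-Reasoning)
open import Data.Integer.DivMod using ([n/ℕd]*d≤n; n<s[n/ℕd]*d; a≡a%ℕn+[a/ℕn]*n; n%ℕd<d)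
open import Data.Integer.Tactic.RingSolver using (solve-∀)
import Data.Nat.Base as ℕ
open import Data.Nat.DivMod using (m≡m%n+[m/n]*n; m%n<n)
open import Relation.Binary.PropositionalEquality using (_≡_; sym; trans; cong; cong₂; subst; module ≡-Reasoning)
open ℕ-Floor using (2r/m+[1+2r]/m+3r/m≤6r/m)

i<suc[j]⇒i≤j : ∀ {i j} → i < sucℤ j → i ≤ j
i<suc[j]⇒i≤j {j = j} i<suc[j] = subst (_ ≤_) (pred-suc j) (i<j⇒i≤pred[j] i<suc[j])

/ℕ-unique : ∀ {i q} d .{{_ : NonZero d}} → q * + d ≤ i → i < sucℤ q * + d → i /ℕ d ≡ q
/ℕ-unique {i} d q*d≤i i<[1+q]*d = ≤-antisym
  (i<suc[j]⇒i≤j (*-cancelʳ-<-nonNeg (+ d) (≤-<-trans ([n/ℕd]*d≤n i d) i<[1+q]*d)))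
  (i<suc[j]⇒i≤j (*-cancelʳ-<-nonNeg (+ d) (≤-<-trans q*d≤i (n<s[n/ℕd]*d i d))))

[r+q*d]/ℕd≡q : ∀ {r} q d .{{_ : NonZero d}} → r <ℕ d → (+ r + q * + d) /ℕ d ≡ q
[r+q*d]/ℕd≡q {r} q d r<d = /ℕ-unique d (i≤j+i (q * + d) (+ r))
  (subst (+ r + q * + d <_) (sym (suc-* q (+ d))) (+-monoˡ-< (q * + d) (+<+ r<d)))

[n+q*d]/ℕd≡q+n/d : ∀ n q d .{{_ : NonZero d}} → (+ n + q * + d) /ℕ d ≡ q + + (n ℕ./ d)
[n+q*d]/ℕd≡q+n/d n q d = trans (cong (_/ℕ d) regroup) ([r+q*d]/ℕd≡q (q + + (n ℕ./ d)) d (m%n<n n d))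
  where
  open ≡-Reasoning
  distrib : ∀ r p q d → r + p * d + q * d ≡ r + (q + p) * d
  distrib = solve-∀
  regroup : + n + q * + d ≡ + (n ℕ.% d) + (q + + (n ℕ./ d)) * + d
  regroup = begin
    + n + q * + d                                  ≡⟨ cong (λ k → + k + q * + d) (m≡m%n+[m/n]*n n d) ⟩
    + (n ℕ.% d) + + (n ℕ./ d ℕ.* d) + q * + d       ≡⟨ cong (λ k → + (n ℕ.% d) + k + q * + d) (pos-* (n ℕ./ d) d) ⟩
    + (n ℕ.% d) + + (n ℕ./ d) * + d + q * + d       ≡⟨ distrib (+ (n ℕ.% d)) (+ (n ℕ./ d)) q (+ d) ⟩
    + (n ℕ.% d) + (q + + (n ℕ./ d)) * + d          ∎

/ℕ-affine : ∀ k c i d .{{_ : NonZero d}} →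
  (+ k * i + + c) /ℕ d ≡ + k * (i /ℕ d) + + ((c ℕ.+ k ℕ.* (i %ℕ d)) ℕ./ d)
/ℕ-affine k c i d =
  trans (cong (_/ℕ d) regroup) ([n+q*d]/ℕd≡q+n/d (c ℕ.+ k ℕ.* (i %ℕ d)) (+ k * (i /ℕ d)) d)
  where
  open ≡-Reasoning
  expand : ∀ k r q d c → k * (r + q * d) + c ≡ c + k * r + k * q * d
  expand = solve-∀
  regroup : + k * i + + c ≡ + (c ℕ.+ k ℕ.* (i %ℕ d)) + + k * (i /ℕ d) * + d
  regroup = begin
    + k * i + + c                                    ≡⟨ cong (λ j → + k * j + + c) (a≡a%ℕn+[a/ℕn]*n i d) ⟩
    + k * (+ (i %ℕ d) + (i /ℕ d) * + d) + + c        ≡⟨ expand (+ k) (+ (i %ℕ d)) (i /ℕ d) (+ d) (+ c) ⟩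
    + c + + k * + (i %ℕ d) + + k * (i /ℕ d) * + d    ≡⟨ cong (λ j → + c + j + + k * (i /ℕ d) * + d) (pos-* k (i %ℕ d)) ⟨
    + (c ℕ.+ k ℕ.* (i %ℕ d)) + + k * (i /ℕ d) * + d  ∎

theorem2p1 : (m : ℕ) → .{{_ : NonZero m}} → 1 <ℕ m → (n : ℤ) →
    ⌊ + 2 * n / m ⌋ + ⌊ + 2 * n + + 1 / m ⌋ + ⌊ + 3 * n / m ⌋ ≤ ⌊ n / m ⌋ + ⌊ + 6 * n / m ⌋
theorem2p1 m 1<m n = begin
  ⌊ + 2 * n / m ⌋ + ⌊ + 2 * n + + 1 / m ⌋ + ⌊ + 3 * n / m ⌋
    ≡⟨ cong₂ _+_ (cong₂ _+_ (/ℕ-linear 2) (/ℕ-affine 2 1 n m)) (/ℕ-linear 3) ⟩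
  (+ 2 * q + + (2 ℕ.* r ℕ./ m)) + (+ 2 * q + + (ℕ.suc (2 ℕ.* r) ℕ./ m)) + (+ 3 * q + + (3 ℕ.* r ℕ./ m))
    ≡⟨ collect q _ _ _ ⟩
  + 7 * q + (+ (2 ℕ.* r ℕ./ m) + + (ℕ.suc (2 ℕ.* r) ℕ./ m) + + (3 ℕ.* r ℕ./ m))
    ≤⟨ +-monoʳ-≤ (+ 7 * q) (+≤+ (2r/m+[1+2r]/m+3r/m≤6r/m m r 1<m (n%ℕd<d n m))) ⟩
  + 7 * q + + (6 ℕ.* r ℕ./ m)
    ≡⟨ split q _ ⟩
  q + (+ 6 * q + + (6 ℕ.* r ℕ./ m))
    ≡⟨ cong (_+_ q) (/ℕ-linear 6) ⟨
  ⌊ n / m ⌋ + ⌊ + 6 * n / m ⌋ ∎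
  where
  open ≤-Reasoning
  q : ℤ
  q = n /ℕ m
  r : ℕ
  r = n %ℕ m
  /ℕ-linear : ∀ k → (+ k * n) /ℕ m ≡ + k * q + + (k ℕ.* r ℕ./ m)
  /ℕ-linear k = trans (cong (_/ℕ m) (sym (+-identityʳ (+ k * n)))) (/ℕ-affine k 0 n m)
  collect : ∀ q a b c → (+ 2 * q + a) + (+ 2 * q + b) + (+ 3 * q + c) ≡ + 7 * q + (a + b + c)
  collect = solve-∀
  split : ∀ q d → + 7 * q + d ≡ q + (+ 6 * q + d)
  split = solve-∀
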